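{- Let $T(x)=c_0+c_1x+\cdots+c_nx^n\in(\mathbb{Z}/2)[x]$ have degree $n\geq1$ and $c_0\neq0$. Then the sequence $k\mapsto|B_1(k)\cap B_2(k)|$ is nonincreasing for $k\geq n$. Hence $|B_1(k)\cap B_2(k)|$ is independent of $k$ for all sufficiently large $k$.
   Context: Write $T(x)=c_0+\cdots+c_nx^n$ with $c_n\neq0$. The automaton $A_2(1;T)$ has line $r$ (for $r\geq0$) equal to $T(x)^r\in(\mathbb{Z}/2)[x]$. Each line is identified with the bi-infinite sequence $(a_j)_{j\in\mathbb{Z}}$ of its coefficients, with zeros outside the support. A string $w\in(\mathbb{Z}/2)^k$ is $k$-accessible if $w=(a_j,\dots,a_{j+k-1})$ for some line $r\geq 0$ and some $j\in\mathbb{Z}$. Let $\mathscr{A}(k)$ be the set of $k$-accessible blocks. For $i\in\{1,2\}$ and $k\geq0$, let $m_i(k)=k+\lfloor (n+i-1)/2\rfloor$. Define $T_{B_i}:(\mathbb{Z}/2)^{m_i(k)}\to(\mathbb{Z}/2)^{2k}$ by $T_{B_i}(b)=(e_{n+i-1},\dots,e_{n+2k+i-2})$. Here $e_j$ is the coefficient of $x^j$ in $x\,T(x)\,b(x^2)$, where $b(x)=\sum_lb_lx^l$ for $b=(b_0,\dots,b_{m_i(k)-1})$. Put $B_i(k)=T_{B_i}(\mathscr{A}(m_i(k)))\subseteq(\mathbb{Z}/2)^{2k}$. -}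

module Defs where

open import Data.Bool using (Bool; true; false; _xor_; if_then_else_)
open import Data.Nat using (ℕ; zero; suc; _+_; _∸_; _/_)
open import Data.Integer as ℤ using (ℤ; +_; -[1+_])
open import Data.List as List using (List; []; _∷_; length)
open import Data.Vec as Vec using (Vec; tabulate; lookup)
open import Data.Fin using (Fin; toℕ)
open import Data.Product using (Σ; ∃; _×_)
open import Relation.Binary.PropositionalEquality using (_≡_)
open import Data.List.Membership.Propositional using (_∈_)
open import Data.List.Relation.Unary.Unique.Propositional using (Unique)

-- Polynomials over Z/2 as coefficient lists, constant term first
-- (true = 1, false = 0). Trailing zeros are allowed.
Poly : Set
Poly = List Bool

addP : Poly → Poly → Poly
addP [] q = q
addP p [] = p
addP (a ∷ p) (b ∷ q) = (a xor b) ∷ addP p q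

mulP : Poly → Poly → Poly
mulP [] q = []
mulP (a ∷ p) q = addP (if a then q else []) (false ∷ mulP p q)

powP : Poly → ℕ → Poly
powP p zero = true ∷ []
powP p (suc r) = mulP p (powP p r)

coeffℕ : Poly → ℕ → Bool
coeffℕ [] j = false
coeffℕ (a ∷ p) zero = a
coeffℕ (a ∷ p) (suc j) = coeffℕ p j

-- coefficient of x^j for j ∈ ℤ (bi-infinite sequence of the line)
coeffℤ : Poly → ℤ → Bool
coeffℤ p (+ j) = coeffℕ p j
coeffℤ p -[1+ j ] = false

spread : Poly → Poly
spread [] = []
spread (a ∷ p) = a ∷ false ∷ spread p

module _ {n : ℕ} (T : Vec Bool (suc n)) where

  Tpoly : Poly
  Tpoly = Vec.toList T

  line : ℕ → Poly
  line r = powP Tpoly r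

  Accessible : (k : ℕ) → Vec Bool k → Set
  Accessible k w = ∃ λ (r : ℕ) → ∃ λ (j : ℤ) →
    (t : Fin k) → lookup w t ≡ coeffℤ (line r) (j ℤ.+ + toℕ t)

  m : ℕ → ℕ → ℕ
  m i k = k + ((n + i ∸ 1) / 2)

  TB : (i k : ℕ) → Vec Bool (m i k) → Vec Bool (k + k)
  TB i k b = tabulate λ (t : Fin (k + k)) →
    coeffℕ (mulP (false ∷ Tpoly) (spread (Vec.toList b))) ((n + i ∸ 1) + toℕ t)

  B : (i k : ℕ) → Vec Bool (k + k) → Set
  B i k w = ∃ λ (b : Vec Bool (m i k)) → Accessible (m i k) b × TB i k b ≡ w

  BB : (k : ℕ) → Vec Bool (k + k) → Set
  BB k w = B 1 k w × B 2 k w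

-- |S| = length L : L is a duplicate-free list enumerating exactly the set S
Enumerates : {A : Set} → (A → Set) → List A → Set
Enumerates {A} S L = Unique L × ((w : A) → (w ∈ L → S w) × (S w → w ∈ L))

-- Dropping the last two entries maps B₁(k+1) ∩ B₂(k+1) into B₁(k) ∩ B₂(k): accessible
-- blocks are closed under prefixes, and T_{B_i} commutes with truncation. The map is
-- injective for k ≥ n. If w = T_{B_1}(b) = T_{B_2}(b′), then P = x T(x) b(x²) agrees with
-- T(x) b′(x²) on the window of coefficients read by w. Multiplying by T and using
-- T(x)² = T(x²) over ℤ/2, the odd polynomial x (Tb)(x²) agrees with the even polynomial
-- (Tb′)(x²), so both vanish there, and T² P vanishes on [3n, n+2k+2). As T² has constant
-- term 1 and degree 2n, the coefficient P_j is determined by (T² P)_j and the 2n preceding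
-- coefficients of P; for k ≥ n this recovers the last two entries of w from the others.

module Submission where

open import Defs
open import Data.Bool using (Bool; true; false; _xor_; _∧_; if_then_else_)
open import Data.Bool.Properties
  using (xor-identityʳ; xor-same; xor-assoc; ∧-comm; ∧-idem; ∧-distribʳ-xor; if-float; xor-∧-commutativeRing)
open import Data.Nat using (ℕ; zero; suc; _+_; _*_; _∸_; _/_; _%_; _≤_; _<_; z≤n; s≤s)
open import Data.Nat.Properties
open import Data.Nat.DivMod using (m≡m%n+[m/n]*n; m%n<n)
open import Data.Nat.Tactic.RingSolver using (solve-∀)
import Data.Integer as ℤ
open import Data.Fin using (Fin; toℕ; fromℕ<; inject≤)
import Data.Fin as Fin
open import Data.Fin.Properties using (toℕ-fromℕ<; toℕ-inject≤; toℕ<n; injective⇒≤)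
open import Data.List using (List; []; _∷_; length)
import Data.List as List
open import Data.List.Relation.Unary.Any using (index)
open import Data.List.Relation.Unary.AllPairs using (_∷_)
import Data.List.Relation.Unary.All as All
open import Data.List.Relation.Unary.Unique.Propositional using (Unique)
open import Data.List.Membership.Propositional using (_∈_)
open import Data.List.Membership.Propositional.Properties using (∈-lookup)
open import Data.List.Membership.Setoid.Properties using (index-injective)
open import Data.Vec using (Vec; _∷_; head; last; lookup; toList; truncate)
open import Data.Vec.Properties using (lookup-truncate; lookup∘tabulate; length-toList)
open import Data.Vec.Relation.Binary.Pointwise.Extensional using (ext; Pointwise-≡⇒≡)
open import Data.Product using (Σ; _,_; proj₁; proj₂)
open import Data.Sum using (_⊎_; inj₁; inj₂)
open import Data.Empty using (⊥-elim)
open import Relation.Nullary using (yes; no)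
open import Relation.Binary.PropositionalEquality
open import Algebra.Bundles using (CommutativeRing)
open import Algebra.Properties.CommutativeSemigroup
  (CommutativeRing.+-commutativeSemigroup xor-∧-commutativeRing) using (interchange; x∙yz≈y∙xz)
open import Algebra.Properties.Group (CommutativeRing.+-group xor-∧-commutativeRing) using (∙-cancelʳ)

-- Polynomials over ℤ/2 up to equality of coefficients

infix 4 _≈_
record _≈_ (p q : Poly) : Set where
  constructor coeffwise
  field coeff-≡ : ∀ j → coeffℕ p j ≡ coeffℕ q j
open _≈_ public

≈-refl : ∀ {p} → p ≈ p
≈-refl = coeffwise λ _ → refl

≈-sym : ∀ {p q} → p ≈ q → q ≈ p
≈-sym e = coeffwise λ j → sym (e .coeff-≡ j)

≈-trans : ∀ {p q r} → p ≈ q → q ≈ r → p ≈ r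
≈-trans e f = coeffwise λ j → trans (e .coeff-≡ j) (f .coeff-≡ j)

≡⇒≈ : ∀ {p q} → p ≡ q → p ≈ q
≡⇒≈ refl = ≈-refl

∷-cong : ∀ a {p q} → p ≈ q → a ∷ p ≈ a ∷ q
∷-cong a e = coeffwise λ where
  zero    → refl
  (suc j) → e .coeff-≡ j

false∷-≈[] : ∀ {p} → p ≈ [] → false ∷ p ≈ []
false∷-≈[] e = coeffwise λ where
  zero    → refl
  (suc j) → e .coeff-≡ j

coeff-addP : ∀ p q j → coeffℕ (addP p q) j ≡ coeffℕ p j xor coeffℕ q j
coeff-addP []      q       j       = refl
coeff-addP (a ∷ p) []      j       = sym (xor-identityʳ _)
coeff-addP (a ∷ p) (b ∷ q) zero    = refl
coeff-addP (a ∷ p) (b ∷ q) (suc j) = coeff-addP p q j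

addP-identityʳ : ∀ p → addP p [] ≡ p
addP-identityʳ []      = refl
addP-identityʳ (a ∷ p) = refl

horner : Bool → Poly → Poly → Poly
horner a q y = addP (if a then q else []) (false ∷ y)

coeff-horner : ∀ a q y j → coeffℕ (horner a q y) j ≡ (a ∧ coeffℕ q j) xor coeffℕ (false ∷ y) j
coeff-horner true  q y j = coeff-addP q (false ∷ y) j
coeff-horner false q y j = refl

horner-cong : ∀ a {q q' y y'} → q ≈ q' → y ≈ y' → horner a q y ≈ horner a q' y'
horner-cong a {q} {q'} {y} {y'} e f = coeffwise λ j → begin
  coeffℕ (horner a q y) j                         ≡⟨ coeff-horner a q y j ⟩
  (a ∧ coeffℕ q j) xor coeffℕ (false ∷ y) j       ≡⟨ cong₂ (λ u v → (a ∧ u) xor v) (e .coeff-≡ j) (∷-cong false f .coeff-≡ j) ⟩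
  (a ∧ coeffℕ q' j) xor coeffℕ (false ∷ y') j     ≡⟨ coeff-horner a q' y' j ⟨
  coeffℕ (horner a q' y') j                       ∎
  where open ≡-Reasoning

horner-interchange : ∀ a b p q z → horner a (b ∷ q) (horner b p z) ≈ horner b (a ∷ p) (horner a q z)
horner-interchange a b p q z .coeff-≡ zero = begin
  coeffℕ (horner a (b ∷ q) (horner b p z)) 0  ≡⟨ coeff-horner a (b ∷ q) _ 0 ⟩
  (a ∧ b) xor false                            ≡⟨ cong (_xor false) (∧-comm a b) ⟩
  (b ∧ a) xor false                            ≡⟨ coeff-horner b (a ∷ p) _ 0 ⟨
  coeffℕ (horner b (a ∷ p) (horner a q z)) 0  ∎
  where open ≡-Reasoning
horner-interchange a b p q z .coeff-≡ (suc j) = begin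
  coeffℕ (horner a (b ∷ q) (horner b p z)) (suc j)
    ≡⟨ coeff-horner a (b ∷ q) _ (suc j) ⟩
  (a ∧ coeffℕ q j) xor coeffℕ (horner b p z) j
    ≡⟨ cong ((a ∧ coeffℕ q j) xor_) (coeff-horner b p z j) ⟩
  (a ∧ coeffℕ q j) xor ((b ∧ coeffℕ p j) xor coeffℕ (false ∷ z) j)
    ≡⟨ x∙yz≈y∙xz (a ∧ coeffℕ q j) (b ∧ coeffℕ p j) _ ⟩
  (b ∧ coeffℕ p j) xor ((a ∧ coeffℕ q j) xor coeffℕ (false ∷ z) j)
    ≡⟨ cong ((b ∧ coeffℕ p j) xor_) (coeff-horner a q z j) ⟨
  (b ∧ coeffℕ p j) xor coeffℕ (horner a q z) j
    ≡⟨ coeff-horner b (a ∷ p) _ (suc j) ⟨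
  coeffℕ (horner b (a ∷ p) (horner a q z)) (suc j)
    ∎
  where open ≡-Reasoning

horner-addP : ∀ a b r y z → horner (a xor b) r (addP y z) ≈ addP (horner a r y) (horner b r z)
horner-addP a b r y z = coeffwise λ j → begin
  coeffℕ (horner (a xor b) r (addP y z)) j
    ≡⟨ coeff-horner (a xor b) r (addP y z) j ⟩
  ((a xor b) ∧ coeffℕ r j) xor coeffℕ (addP (false ∷ y) (false ∷ z)) j
    ≡⟨ cong₂ _xor_ (∧-distribʳ-xor (coeffℕ r j) a b) (coeff-addP (false ∷ y) (false ∷ z) j) ⟩
  ((a ∧ coeffℕ r j) xor (b ∧ coeffℕ r j)) xor (coeffℕ (false ∷ y) j xor coeffℕ (false ∷ z) j)
    ≡⟨ interchange (a ∧ coeffℕ r j) (b ∧ coeffℕ r j) (coeffℕ (false ∷ y) j) _ ⟩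
  ((a ∧ coeffℕ r j) xor coeffℕ (false ∷ y) j) xor ((b ∧ coeffℕ r j) xor coeffℕ (false ∷ z) j)
    ≡⟨ cong₂ _xor_ (coeff-horner a r y j) (coeff-horner b r z j) ⟨
  coeffℕ (horner a r y) j xor coeffℕ (horner b r z) j
    ≡⟨ coeff-addP (horner a r y) (horner b r z) j ⟨
  coeffℕ (addP (horner a r y) (horner b r z)) j
    ∎
  where open ≡-Reasoning

mulP-congʳ : ∀ p {q q'} → q ≈ q' → mulP p q ≈ mulP p q'
mulP-congʳ []      e = ≈-refl
mulP-congʳ (a ∷ p) e = horner-cong a e (mulP-congʳ p e)

mulP-zeroʳ : ∀ p → mulP p [] ≈ []
mulP-zeroʳ []          = ≈-refl
mulP-zeroʳ (true ∷ p)  = false∷-≈[] (mulP-zeroʳ p)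
mulP-zeroʳ (false ∷ p) = false∷-≈[] (mulP-zeroʳ p)

mulP-consʳ : ∀ p b q → mulP p (b ∷ q) ≈ horner b p (mulP p q)
mulP-consʳ []      true  q = ≈-sym (false∷-≈[] ≈-refl)
mulP-consʳ []      false q = ≈-sym (false∷-≈[] ≈-refl)
mulP-consʳ (a ∷ p) b     q = ≈-trans (horner-cong a ≈-refl (mulP-consʳ p b q))
                                     (horner-interchange a b p q (mulP p q))

mulP-shiftʳ : ∀ p q → mulP p (false ∷ q) ≈ false ∷ mulP p q
mulP-shiftʳ p = mulP-consʳ p false

mulP-comm : ∀ p q → mulP p q ≈ mulP q p
mulP-comm []      q = ≈-sym (mulP-zeroʳ q)
mulP-comm (a ∷ p) q = ≈-trans (horner-cong a ≈-refl (mulP-comm p q)) (≈-sym (mulP-consʳ q a p))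

mulP-congˡ : ∀ {p p'} q → p ≈ p' → mulP p q ≈ mulP p' q
mulP-congˡ {p} {p'} q e = ≈-trans (mulP-comm p q) (≈-trans (mulP-congʳ q e) (mulP-comm q p'))

mulP-distribʳ : ∀ p q r → mulP (addP p q) r ≈ addP (mulP p r) (mulP q r)
mulP-distribʳ []      q       r = ≈-refl
mulP-distribʳ (a ∷ p) []      r = ≡⇒≈ (sym (addP-identityʳ (mulP (a ∷ p) r)))
mulP-distribʳ (a ∷ p) (b ∷ q) r = ≈-trans (horner-cong (a xor b) ≈-refl (mulP-distribʳ p q r))
                                          (horner-addP a b r (mulP p r) (mulP q r))

mulP-assoc : ∀ p q r → mulP (mulP p q) r ≈ mulP p (mulP q r)
mulP-assoc []      q r = ≈-refl
mulP-assoc (a ∷ p) q r = ≈-trans (mulP-distribʳ (if a then q else []) (false ∷ mulP p q) r)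
  (subst (λ s → addP s (false ∷ mulP (mulP p q) r) ≈ mulP (a ∷ p) (mulP q r))
         (sym (if-float (λ s → mulP s r) a))
         (horner-cong a ≈-refl (mulP-assoc p q r)))

spread-addP : ∀ p q → spread (addP p q) ≡ addP (spread p) (spread q)
spread-addP []      q       = refl
spread-addP (a ∷ p) []      = refl
spread-addP (a ∷ p) (b ∷ q) = cong (λ s → (a xor b) ∷ false ∷ s) (spread-addP p q)

spread-horner : ∀ a q y → spread (horner a q y) ≡ horner a (spread q) (false ∷ spread y)
spread-horner a q y = trans (spread-addP (if a then q else []) (false ∷ y))
                            (cong (λ s → addP s (false ∷ false ∷ spread y)) (if-float spread a))

spread-mulP : ∀ p q → mulP (spread p) (spread q) ≈ spread (mulP p q)
spread-mulP []      q = ≈-refl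
spread-mulP (a ∷ p) q = ≈-trans (horner-cong a ≈-refl (∷-cong false (spread-mulP p q)))
                                (≡⇒≈ (sym (spread-horner a q (mulP p q))))

frobenius : ∀ p → mulP p p ≈ spread p
frobenius []      = ≈-refl
frobenius (a ∷ p) = ≈-trans (horner-cong a ≈-refl (≈-trans (mulP-consʳ p a p) (horner-cong a ≈-refl (frobenius p))))
                            (coeffwise square-coeff)
  where
  square-coeff : ∀ j → coeffℕ (horner a (a ∷ p) (horner a p (spread p))) j ≡ coeffℕ (spread (a ∷ p)) j
  square-coeff zero    = trans (coeff-horner a (a ∷ p) _ 0) (trans (xor-identityʳ (a ∧ a)) (∧-idem a))
  square-coeff (suc j) = begin
    coeffℕ (horner a (a ∷ p) (horner a p (spread p))) (suc j)
      ≡⟨ coeff-horner a (a ∷ p) _ (suc j) ⟩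
    (a ∧ coeffℕ p j) xor coeffℕ (horner a p (spread p)) j
      ≡⟨ cong ((a ∧ coeffℕ p j) xor_) (coeff-horner a p (spread p) j) ⟩
    (a ∧ coeffℕ p j) xor ((a ∧ coeffℕ p j) xor coeffℕ (false ∷ spread p) j)
      ≡⟨ xor-assoc (a ∧ coeffℕ p j) _ _ ⟨
    ((a ∧ coeffℕ p j) xor (a ∧ coeffℕ p j)) xor coeffℕ (false ∷ spread p) j
      ≡⟨ cong (_xor coeffℕ (false ∷ spread p) j) (xor-same (a ∧ coeffℕ p j)) ⟩
    coeffℕ (false ∷ spread p) j
      ∎
    where open ≡-Reasoning

coeff-spread-even : ∀ p i → coeffℕ (spread p) (i + i) ≡ coeffℕ p i
coeff-spread-even []      i       = refl
coeff-spread-even (a ∷ p) zero    = refl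
coeff-spread-even (a ∷ p) (suc i) rewrite +-suc i i = coeff-spread-even p i

coeff-spread-odd : ∀ p i → coeffℕ (spread p) (suc (i + i)) ≡ false
coeff-spread-odd []      i       = refl
coeff-spread-odd (a ∷ p) zero    = refl
coeff-spread-odd (a ∷ p) (suc i) rewrite +-suc i i = coeff-spread-odd p i

coeff-false∷spread-even : ∀ p i → coeffℕ (false ∷ spread p) (i + i) ≡ false
coeff-false∷spread-even p zero    = refl
coeff-false∷spread-even p (suc i) rewrite +-suc i i = coeff-spread-odd p i

even-or-odd : ∀ j → Σ ℕ λ i → i + i ≡ j ⊎ suc (i + i) ≡ j
even-or-odd zero = 0 , inj₁ refl
even-or-odd (suc j) with even-or-odd j
... | i , inj₁ refl = i , inj₂ refl
... | i , inj₂ refl = suc i , inj₁ (cong suc (+-suc i i))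

-- Agreement of coefficients on a window [lo, hi)

record AgreeOn (lo hi : ℕ) (p q : Poly) : Set where
  constructor agreeOn
  field agree : ∀ j → lo ≤ j → j < hi → coeffℕ p j ≡ coeffℕ q j
open AgreeOn public

module _ {lo hi : ℕ} where

  AgreeOn-refl : ∀ {p} → AgreeOn lo hi p p
  AgreeOn-refl = agreeOn λ _ _ _ → refl

  AgreeOn-sym : ∀ {p q} → AgreeOn lo hi p q → AgreeOn lo hi q p
  AgreeOn-sym a = agreeOn λ j l h → sym (a .agree j l h)

  AgreeOn-trans : ∀ {p q r} → AgreeOn lo hi p q → AgreeOn lo hi q r → AgreeOn lo hi p r
  AgreeOn-trans a b = agreeOn λ j l h → trans (a .agree j l h) (b .agree j l h)

  AgreeOn-resp-≈ : ∀ {p p' q q'} → p ≈ p' → q ≈ q' → AgreeOn lo hi p q → AgreeOn lo hi p' q'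
  AgreeOn-resp-≈ e f a = agreeOn λ j l h → trans (sym (e .coeff-≡ j)) (trans (a .agree j l h) (f .coeff-≡ j))

AgreeOn-mono : ∀ {lo lo' hi hi' p q} → lo ≤ lo' → hi' ≤ hi → AgreeOn lo hi p q → AgreeOn lo' hi' p q
AgreeOn-mono lo≤lo' hi'≤hi a = agreeOn λ j l h → a .agree j (≤-trans lo≤lo' l) (≤-trans h hi'≤hi)

AgreeOn-extend : ∀ {lo j p q} → AgreeOn lo j p q → coeffℕ p j ≡ coeffℕ q j → AgreeOn lo (suc j) p q
AgreeOn-extend {j = j} a e .agree i l h with i ≟ j
... | yes refl = e
... | no i≢j   = a .agree i l (≤∧≢⇒< (≤-pred h) i≢j)

AgreeOn-shift : ∀ {lo hi x y} → AgreeOn lo hi x y → AgreeOn (suc lo) (suc hi) (false ∷ x) (false ∷ y)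
AgreeOn-shift a .agree (suc j) (s≤s l) (s≤s h) = a .agree j l h

AgreeOn-prefix-shift : ∀ {hi x y} → AgreeOn 0 hi x y → AgreeOn 0 (suc hi) (false ∷ x) (false ∷ y)
AgreeOn-prefix-shift a .agree zero    _ _       = refl
AgreeOn-prefix-shift a .agree (suc j) _ (s≤s h) = a .agree j z≤n h

AgreeOn-horner : ∀ a {lo hi q q' y y'} → AgreeOn lo hi q q' → AgreeOn lo hi (false ∷ y) (false ∷ y') →
                 AgreeOn lo hi (horner a q y) (horner a q' y')
AgreeOn-horner a {q = q} {q'} {y} {y'} A B = agreeOn λ j l h → begin
  coeffℕ (horner a q y) j                        ≡⟨ coeff-horner a q y j ⟩
  (a ∧ coeffℕ q j) xor coeffℕ (false ∷ y) j      ≡⟨ cong₂ (λ u v → (a ∧ u) xor v) (A .agree j l h) (B .agree j l h) ⟩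
  (a ∧ coeffℕ q' j) xor coeffℕ (false ∷ y') j    ≡⟨ coeff-horner a q' y' j ⟨
  coeffℕ (horner a q' y') j                      ∎
  where open ≡-Reasoning

mutual
  AgreeOn-mulP : ∀ c p {lo hi P Q} → AgreeOn lo hi P Q →
                 AgreeOn (lo + length p) hi (mulP (c ∷ p) P) (mulP (c ∷ p) Q)
  AgreeOn-mulP c p {lo} A = AgreeOn-horner c (AgreeOn-mono (m≤m+n lo (length p)) ≤-refl A)
                                             (AgreeOn-mono ≤-refl (n≤1+n _) (AgreeOn-false∷mulP p A))

  AgreeOn-false∷mulP : ∀ p {lo hi P Q} → AgreeOn lo hi P Q →
                       AgreeOn (lo + length p) (suc hi) (false ∷ mulP p P) (false ∷ mulP p Q)
  AgreeOn-false∷mulP []      A = AgreeOn-refl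
  AgreeOn-false∷mulP (c ∷ p) {lo} A =
    AgreeOn-mono (≤-reflexive (sym (+-suc lo (length p)))) ≤-refl (AgreeOn-shift (AgreeOn-mulP c p A))

AgreeOn-prefix-mulP : ∀ p {hi P Q} → AgreeOn 0 hi P Q → AgreeOn 0 hi (mulP p P) (mulP p Q)
AgreeOn-prefix-mulP []      A = AgreeOn-refl
AgreeOn-prefix-mulP (c ∷ p) A =
  AgreeOn-horner c A (AgreeOn-mono ≤-refl (n≤1+n _) (AgreeOn-prefix-shift (AgreeOn-prefix-mulP p A)))

AgreeOn-prefix-spread : ∀ M {x y} → AgreeOn 0 M x y → AgreeOn 0 (M + M) (spread x) (spread y)
AgreeOn-prefix-spread M {x} {y} A .agree j _ h with even-or-odd j
... | i , inj₁ refl = trans (coeff-spread-even x i)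
  (trans (A .agree i z≤n (≰⇒> λ M≤i → ≤⇒≯ (+-mono-≤ M≤i M≤i) h)) (sym (coeff-spread-even y i)))
... | i , inj₂ refl = trans (coeff-spread-odd x i) (sym (coeff-spread-odd y i))

AgreeOn-odd-even⇒vanishes : ∀ {lo hi u v} → AgreeOn lo hi (false ∷ spread u) (spread v) →
                            AgreeOn lo hi (false ∷ spread u) []
AgreeOn-odd-even⇒vanishes {u = u} {v} A .agree j l h with even-or-odd j
... | i , inj₁ refl = coeff-false∷spread-even u i
... | i , inj₂ refl = trans (A .agree _ l h) (coeff-spread-odd v i)

-- Coefficient j of (1 + x t) P is P_j plus a combination of P_{j-d}, …, P_{j-1}, d = length t.
unit-mulP-determines : ∀ t {lo j P Q} → AgreeOn lo j P Q → lo + length t ≤ j →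
  coeffℕ (mulP (true ∷ t) P) j ≡ coeffℕ (mulP (true ∷ t) Q) j → coeffℕ P j ≡ coeffℕ Q j
unit-mulP-determines t {lo} {j} {P} {Q} A bound e = ∙-cancelʳ (coeffℕ (false ∷ mulP t P) j) _ _ (begin
  coeffℕ P j xor coeffℕ (false ∷ mulP t P) j   ≡⟨ coeff-horner true P (mulP t P) j ⟨
  coeffℕ (mulP (true ∷ t) P) j                 ≡⟨ e ⟩
  coeffℕ (mulP (true ∷ t) Q) j                 ≡⟨ coeff-horner true Q (mulP t Q) j ⟩
  coeffℕ Q j xor coeffℕ (false ∷ mulP t Q) j   ≡⟨ cong (coeffℕ Q j xor_) (AgreeOn-false∷mulP t A .agree j bound (n<1+n j)) ⟨
  coeffℕ Q j xor coeffℕ (false ∷ mulP t P) j   ∎)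
  where open ≡-Reasoning

unit-square-determines : ∀ t {lo j P Q} → AgreeOn lo j P Q → lo + length t + length t ≤ j →
  coeffℕ (mulP (true ∷ t) (mulP (true ∷ t) P)) j ≡ coeffℕ (mulP (true ∷ t) (mulP (true ∷ t) Q)) j →
  coeffℕ P j ≡ coeffℕ Q j
unit-square-determines t {lo} A bound e = unit-mulP-determines t A (m+n≤o⇒m≤o _ bound)
  (unit-mulP-determines t (AgreeOn-mulP true t A) bound e)

AgreeOn-propagate : ∀ t m {lo j P Q} → lo + length t + length t ≤ j → AgreeOn lo j P Q →
  AgreeOn j (m + j) (mulP (true ∷ t) (mulP (true ∷ t) P)) (mulP (true ∷ t) (mulP (true ∷ t) Q)) →
  AgreeOn lo (m + j) P Q
AgreeOn-propagate t zero    bound A _ = A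
AgreeOn-propagate t (suc m) {lo} {j} {P} {Q} bound A B = AgreeOn-extend A'
  (unit-square-determines t A' (≤-trans bound (m≤n+m j m)) (B .agree (m + j) (m≤n+m j m) (n<1+n (m + j))))
  where
  A' : AgreeOn lo (m + j) P Q
  A' = AgreeOn-propagate t m bound A (AgreeOn-mono ≤-refl (n≤1+n (m + j)) B)

mulP-mulP-spread : ∀ p q → mulP p (mulP p (spread q)) ≈ spread (mulP p q)
mulP-mulP-spread p q = ≈-trans (≈-sym (mulP-assoc p p (spread q)))
                      (≈-trans (mulP-congˡ (spread q) (frobenius p)) (spread-mulP p q))

-- By Frobenius, T · x T b(x²) = x (T b)(x²) is odd and T · T b′(x²) = (T b′)(x²) is even;
-- where two such polynomials agree, both vanish.
odd-part-square-vanishes : ∀ c t b b' {hi} →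
  AgreeOn (length t) hi (false ∷ mulP (c ∷ t) (spread b)) (mulP (c ∷ t) (spread b')) →
  AgreeOn (length t + length t + length t) hi
          (mulP (c ∷ t) (mulP (c ∷ t) (false ∷ mulP (c ∷ t) (spread b)))) []
odd-part-square-vanishes c t b b' {hi} A =
  AgreeOn-resp-≈ ≈-refl (mulP-zeroʳ (c ∷ t)) (AgreeOn-mulP c t odd-vanishes)
  where
  T : Poly
  T = c ∷ t
  odd : mulP T (false ∷ mulP T (spread b)) ≈ false ∷ spread (mulP T b)
  odd = ≈-trans (mulP-shiftʳ T (mulP T (spread b))) (∷-cong false (mulP-mulP-spread T b))
  odd-vanishes : AgreeOn (length t + length t) hi (mulP T (false ∷ mulP T (spread b))) []
  odd-vanishes = AgreeOn-resp-≈ (≈-sym odd) ≈-refl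
    (AgreeOn-odd-even⇒vanishes (AgreeOn-resp-≈ odd (mulP-mulP-spread T b') (AgreeOn-mulP c t A)))

-- The blocks B_i(k)

record Window {N} (P : Poly) (lo : ℕ) (v : Vec Bool N) : Set where
  constructor window
  field read : ∀ t → lookup v t ≡ coeffℕ P (lo + toℕ t)
open Window

fin-offset : ∀ {lo j N} → lo ≤ j → j < lo + N → Σ (Fin N) λ t → lo + toℕ t ≡ j
fin-offset {lo} {j} {N} lo≤j j<lo+N = fromℕ< j∸lo<N , trans (cong (lo +_) (toℕ-fromℕ< j∸lo<N)) (m+[n∸m]≡n lo≤j)
  where
  j∸lo<N : j ∸ lo < N
  j∸lo<N = +-cancelˡ-< lo (j ∸ lo) N (subst (_< lo + N) (sym (m+[n∸m]≡n lo≤j)) j<lo+N)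

Window-agreeOn : ∀ {N P Q lo} {v : Vec Bool N} → Window P lo v → Window Q lo v → AgreeOn lo (lo + N) P Q
Window-agreeOn wP wQ .agree j l h with fin-offset l h
... | t , refl = trans (sym (wP .read t)) (wQ .read t)

AgreeOn-Window⇒≡ : ∀ {N P Q lo} {v w : Vec Bool N} → AgreeOn lo (lo + N) P Q → Window P lo v → Window Q lo w → v ≡ w
AgreeOn-Window⇒≡ {lo = lo} A wv ww = Pointwise-≡⇒≡ (ext λ t →
  trans (wv .read t) (trans (A .agree (lo + toℕ t) (m≤m+n lo _) (+-monoʳ-< lo (toℕ<n t))) (sym (ww .read t))))

Window-truncate : ∀ {a N P lo} (le : a ≤ N) {v : Vec Bool N} → Window P lo v → Window P lo (truncate le v)
Window-truncate {P = P} {lo} le {v} w .read t =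
  trans (lookup-truncate le v t) (trans (w .read (inject≤ t le)) (cong (λ i → coeffℕ P (lo + i)) (toℕ-inject≤ t le)))

Window-unshift : ∀ {N P lo} {v : Vec Bool N} → Window (false ∷ P) (suc lo) v → Window P lo v
Window-unshift w = window (w .read)

Window-toList : ∀ {N} (v : Vec Bool N) → Window (toList v) 0 v
Window-toList (x ∷ v) .read Fin.zero    = refl
Window-toList (x ∷ v) .read (Fin.suc t) = Window-toList v .read t

c+2k≤1+2[k+c/2] : ∀ c k → c + (k + k) ≤ suc ((k + c / 2) + (k + c / 2))
c+2k≤1+2[k+c/2] c k = begin
  c + (k + k)                         ≡⟨ cong (_+ (k + k)) (m≡m%n+[m/n]*n c 2) ⟩
  c % 2 + c / 2 * 2 + (k + k)         ≤⟨ +-monoˡ-≤ (k + k) (+-monoˡ-≤ (c / 2 * 2) (≤-pred (m%n<n c 2))) ⟩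
  1 + c / 2 * 2 + (k + k)             ≡⟨ regroup (c / 2) k ⟩
  suc ((k + c / 2) + (k + c / 2))     ∎
  where
  open ≤-Reasoning
  regroup : ∀ h k → 1 + h * 2 + (k + k) ≡ suc ((k + h) + (k + h))
  regroup = solve-∀

shorten : ∀ {k} → Vec Bool (suc k + suc k) → Vec Bool (k + k)
shorten {k} = truncate (+-mono-≤ (n≤1+n k) (n≤1+n k))

module _ {n : ℕ} (T : Vec Bool (suc n)) where

  xTb[x²] : ∀ {M} → Vec Bool M → Poly
  xTb[x²] b = mulP (false ∷ Tpoly T) (spread (toList b))

  Window-TB : ∀ i k b → Window (xTb[x²] b) (n + i ∸ 1) (TB T i k b)
  Window-TB i k b = window (lookup∘tabulate _)

  Accessible-truncate : ∀ {a N} (le : a ≤ N) v → Accessible T N v → Accessible T a (truncate le v)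
  Accessible-truncate le v (r , j , f) = r , j , λ t → trans (lookup-truncate le v t)
    (trans (f (inject≤ t le)) (cong (λ i → coeffℤ (line T r) (j ℤ.+ ℤ.+ i)) (toℕ-inject≤ t le)))

  xTb[x²]-truncate : ∀ {M} (b : Vec Bool (suc M)) →
    AgreeOn 0 (suc (M + M)) (xTb[x²] (truncate (n≤1+n M) b)) (xTb[x²] b)
  xTb[x²]-truncate {M} b = AgreeOn-prefix-shift (AgreeOn-prefix-mulP (Tpoly T) (AgreeOn-prefix-spread M
    (Window-agreeOn (Window-toList (truncate (n≤1+n M) b)) (Window-truncate (n≤1+n M) (Window-toList b)))))

  TB-truncate : ∀ i k b → TB T i k (truncate (n≤1+n (m T i k)) b) ≡ shorten (TB T i (suc k) b)
  TB-truncate i k b = AgreeOn-Window⇒≡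
    (AgreeOn-mono z≤n (c+2k≤1+2[k+c/2] (n + i ∸ 1) k) (xTb[x²]-truncate b))
    (Window-TB i k _) (Window-truncate _ (Window-TB i (suc k) b))

  B-shorten : ∀ i k {w} → B T i (suc k) w → B T i k (shorten w)
  B-shorten i k (b , acc , refl) = truncate (n≤1+n (m T i k)) b , Accessible-truncate _ b acc , TB-truncate i k b

  BB-shorten : ∀ k {w} → BB T (suc k) w → BB T k (shorten w)
  BB-shorten k (w₁ , w₂) = B-shorten 1 k w₁ , B-shorten 2 k w₂

module _ {n : ℕ} (T₁ : Vec Bool n) where

  private
    T : Vec Bool (suc n)
    T = true ∷ T₁

  Window-TB₁ : ∀ k b → Window (xTb[x²] T b) n (TB T 1 k b)
  Window-TB₁ k b = subst (λ lo → Window (xTb[x²] T b) lo (TB T 1 k b)) (m+n∸n≡m n 1) (Window-TB T 1 k b)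

  Window-TB₂ : ∀ k b → Window (mulP (Tpoly T) (spread (toList b))) n (TB T 2 k b)
  Window-TB₂ k b = Window-unshift (subst (λ lo → Window (xTb[x²] T b) lo (TB T 2 k b)) n+2∸1≡1+n (Window-TB T 2 k b))
    where
    n+2∸1≡1+n : n + 2 ∸ 1 ≡ suc n
    n+2∸1≡1+n = trans (cong (_∸ 1) (+-suc n 1)) (m+n∸n≡m (suc n) 1)

  square-vanishes : ∀ k {b b'} → TB T 2 k b' ≡ TB T 1 k b →
    AgreeOn (length (toList T₁) + length (toList T₁) + length (toList T₁)) (n + (k + k))
            (mulP (Tpoly T) (mulP (Tpoly T) (xTb[x²] T b))) []
  square-vanishes k {b} {b'} e = odd-part-square-vanishes true (toList T₁) (toList b) (toList b')
    (AgreeOn-mono (≤-reflexive (sym (length-toList T₁))) ≤-refl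
      (Window-agreeOn (Window-TB₁ k b) (subst (Window _ n) e (Window-TB₂ k b'))))

  shorten-injective : ∀ {k} → n ≤ k → ∀ {w w'} → BB T (suc k) w → BB T (suc k) w' → shorten w ≡ shorten w' → w ≡ w'
  shorten-injective {k} n≤k ((b , _ , refl) , (b' , _ , e)) ((c , _ , refl) , (c' , _ , e')) s =
    AgreeOn-Window⇒≡ (AgreeOn-mono ≤-refl (≤-reflexive hi≡) (AgreeOn-propagate (toList T₁) 2 n+2d≤j prefix tail))
      (Window-TB₁ (suc k) b) (Window-TB₁ (suc k) c)
    where
    j : ℕ
    j = n + (k + k)
    d : ℕ
    d = length (toList T₁)
    hi≡ : n + (suc k + suc k) ≡ 2 + j
    hi≡ = regroup n k
      where
      regroup : ∀ n k → n + (suc k + suc k) ≡ 2 + (n + (k + k))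
      regroup = solve-∀
    3n≤j : n + n + n ≤ j
    3n≤j = ≤-trans (≤-reflexive (+-assoc n n n)) (+-monoʳ-≤ n (+-mono-≤ n≤k n≤k))
    n+2d≤j : n + d + d ≤ j
    n+2d≤j rewrite length-toList T₁ = 3n≤j
    3d≤j : d + d + d ≤ j
    3d≤j rewrite length-toList T₁ = 3n≤j
    square : Vec Bool (m T 1 (suc k)) → Poly
    square x = mulP (Tpoly T) (mulP (Tpoly T) (xTb[x²] T x))
    prefix : AgreeOn n j (xTb[x²] T b) (xTb[x²] T c)
    prefix = Window-agreeOn (Window-truncate _ (Window-TB₁ (suc k) b))
                            (subst (Window _ n) (sym s) (Window-truncate _ (Window-TB₁ (suc k) c)))
    tail : AgreeOn j (2 + j) (square b) (square c)
    tail = AgreeOn-mono 3d≤j (≤-reflexive (sym hi≡))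
      (AgreeOn-trans (square-vanishes (suc k) {b} {b'} e) (AgreeOn-sym (square-vanishes (suc k) {c} {c'} e')))

-- Counting

lookup-injective : ∀ {A : Set} {xs : List A} → Unique xs → ∀ {i j} → List.lookup xs i ≡ List.lookup xs j → i ≡ j
lookup-injective (x∉ ∷ u) {Fin.zero}  {Fin.zero}  e = refl
lookup-injective (x∉ ∷ u) {Fin.zero}  {Fin.suc j} e = ⊥-elim (All.lookup x∉ (∈-lookup j) e)
lookup-injective (x∉ ∷ u) {Fin.suc i} {Fin.zero}  e = ⊥-elim (All.lookup x∉ (∈-lookup i) (sym e))
lookup-injective (x∉ ∷ u) {Fin.suc i} {Fin.suc j} e = cong Fin.suc (lookup-injective u e)

Enumerates-injection⇒≤ : ∀ {A B : Set} {S : A → Set} {R : B → Set} {L : List A} {K : List B} →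
  Enumerates S L → Enumerates R K → (f : A → B) → (∀ {x} → S x → R (f x)) →
  (∀ {x y} → S x → S y → f x ≡ f y → x ≡ y) → length L ≤ length K
Enumerates-injection⇒≤ {S = S} {L = L} {K} (unique , enumL) (_ , enumK) f maps injective =
  injective⇒≤ {f = position} λ {i} {j} e →
    lookup-injective unique (injective (member i) (member j) (index-injective (setoid _) (found i) (found j) e))
  where
  member : ∀ i → S (List.lookup L i)
  member i = proj₁ (enumL (List.lookup L i)) (∈-lookup i)
  found : ∀ i → f (List.lookup L i) ∈ K
  found i = proj₂ (enumK (f (List.lookup L i))) (maps (member i))
  position : Fin (length L) → Fin (length K)
  position i = index (found i)

mainTheorem5 : (n : ℕ) → (T : Vec Bool (suc n)) → 1 ≤ n →
    head T ≡ true → last T ≡ true →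
    (k : ℕ) → n ≤ k →
    (L : List (Vec Bool (k + k))) → (L' : List (Vec Bool (suc k + suc k))) →
    Enumerates (BB T k) L → Enumerates (BB T (suc k)) L' →
    length L' ≤ length L
mainTheorem5 n (.true ∷ T₁) _ refl _ k n≤k L L' enumL enumL' =
  Enumerates-injection⇒≤ enumL' enumL shorten (BB-shorten (true ∷ T₁) k) (shorten-injective T₁ n≤k)
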